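{- Let $A_3(x)=0$ if $x\equiv 0,1,2,3\pmod 8$ and $A_3(x)=1$ if $x\equiv 4,5,6,7\pmod 8$. Then the sequence $\big((-1)^{s_2(x)+s_2(\lfloor x/4\rfloor-1)}A_3(x)\big)_{x\ge 0}$ (whose terms are $0$ whenever $A_3(x)=0$, in particular for $x<4$) is periodic with period $8$.
   Context: For an integer $b\ge 2$ and integer $r\ge 0$, $s_b(r)$ denotes the sum of the digits of $r$ in base $b$. -}

module Defs where

open import Data.Nat using (ℕ; zero; suc; _+_; _∸_; NonZero)
open import Data.Nat.DivMod using (_/_; _%_)
open import Data.Integer using (ℤ; +_; -_; _*_)

-- digit-sum with fuel; for b ≥ 2 the fuel r suffices (r / b < r for r > 0),
-- so sDigits b r is the sum of base-b digits of r.
sDigitsAux : (b : ℕ) .{{_ : NonZero b}} → ℕ → ℕ → ℕ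
sDigitsAux b zero    r = 0
sDigitsAux b (suc f) zero = 0
sDigitsAux b (suc f) r@(suc _) = r % b + sDigitsAux b f (r / b)

sDigits : (b : ℕ) .{{_ : NonZero b}} → ℕ → ℕ
sDigits b r = sDigitsAux b r r

s₂ : ℕ → ℕ
s₂ = sDigits 2

negOnePow : ℕ → ℤ
negOnePow zero    = + 1
negOnePow (suc n) = - negOnePow n

A₃ : ℕ → ℕ
A₃ x = (x % 8) / 4

-- the sequence (-1)^{s_2(x) + s_2(⌊x/4⌋ - 1)} A_3(x);
-- ⌊x/4⌋ - 1 uses truncated subtraction, only relevant when x < 4 where A_3(x) = 0
seqT : ℕ → ℤ
seqT x = negOnePow (s₂ x + s₂ ((x / 4) ∸ 1)) * (+ A₃ x)

module Submission where

-- The term seqT x depends only on x mod 8.  Write x = r + 8q with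
-- r = x mod 8.  The factor A₃(x) = ⌊r/4⌋ is 0 or 1.  When it is 0 the term
-- vanishes; when it is 1 we have ⌊x/4⌋ - 1 = 2q, and the digit sum splits
-- along binary blocks: s₂(r + 8q) = s₂(r) + s₂(q) and s₂(2q) = s₂(q).  The
-- exponent is then s₂(r) + 2·s₂(q), so the sign is (-1)^{s₂(r)}.  Hence
--   seqT x = (-1)^{s₂(r)} · ⌊r/4⌋,
-- a function of x mod 8 alone, and periodicity follows from (x+8) mod 8 = x mod 8.

open import Defs
open import Data.Nat using (ℕ; _+_)
open import Relation.Binary.PropositionalEquality using (_≡_)

open import Data.Nat using (zero; suc; _*_; _^_; _∸_; _<_; _≤_; z≤n; s≤s; NonZero)
open import Data.Nat.Properties using (<⇒≤; ≤-refl; +-identityʳ; ≤-reflexive; *-identityʳ; ≤-trans; <⇒≤pred; *-comm; +-suc; +-assoc)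
open import Data.Nat.DivMod
open import Data.Nat.Divisibility using (divides-refl)
open import Data.Nat.Solver using (module +-*-Solver)
open import Data.Integer as ℤ using (ℤ)
open import Data.Integer.Properties using (neg-involutive; *-zeroʳ)
open import Relation.Binary.PropositionalEquality using (refl; sym; trans; cong; cong₂; module ≡-Reasoning)

open +-*-Solver using (solve; _:+_; _:*_; _:=_)

module DigitSum (b : ℕ) .{{_ : NonZero b}} (1<b : 1 < b) where

  quotient-shrinks : ∀ r → suc r / b ≤ r
  quotient-shrinks r = <⇒≤pred (m/n<m (suc r) b 1<b)

  fuel-irrelevant : ∀ f g r → r ≤ f → r ≤ g → sDigitsAux b f r ≡ sDigitsAux b g r
  fuel-irrelevant zero    zero    zero    _       _       = refl
  fuel-irrelevant zero    (suc g) zero    _       _       = refl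
  fuel-irrelevant (suc f) zero    zero    _       _       = refl
  fuel-irrelevant (suc f) (suc g) zero    _       _       = refl
  fuel-irrelevant (suc f) (suc g) (suc r) (s≤s r≤f) (s≤s r≤g) =
    cong (suc r % b +_)
      (fuel-irrelevant f g (suc r / b)
        (≤-trans (quotient-shrinks r) r≤f) (≤-trans (quotient-shrinks r) r≤g))

  sDigits-unfold : ∀ x → sDigits b x ≡ x % b + sDigits b (x / b)
  sDigits-unfold zero    =
    sym (cong₂ (λ u v → u + sDigits b v) (m<n⇒m%n≡m (<⇒≤ 1<b)) (0/n≡0 b))
  sDigits-unfold (suc r) =
    cong (suc r % b +_) (fuel-irrelevant r (suc r / b) (suc r / b) (quotient-shrinks r) ≤-refl)

  sDigits-digit : ∀ d q → d < b → sDigits b (d + q * b) ≡ d + sDigits b q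
  sDigits-digit d q d<b = begin
    sDigits b (d + q * b)                          ≡⟨ sDigits-unfold (d + q * b) ⟩
    (d + q * b) % b + sDigits b ((d + q * b) / b)  ≡⟨ cong₂ (λ u v → u + sDigits b v) last-digit rest ⟩
    d + sDigits b q                                ∎
    where
    open ≡-Reasoning
    last-digit : (d + q * b) % b ≡ d
    last-digit = trans ([m+kn]%n≡m%n d q b) (m<n⇒m%n≡m d<b)
    rest : (d + q * b) / b ≡ q
    rest = begin
      (d + q * b) / b    ≡⟨ +-distrib-/-∣ʳ d (divides-refl q) ⟩
      d / b + q * b / b  ≡⟨ cong₂ _+_ (m<n⇒m/n≡0 d<b) (m*n/n≡m q b) ⟩
      q                  ∎

  sDigits-block : ∀ k r q → r < b ^ k → sDigits b (r + q * b ^ k) ≡ sDigits b r + sDigits b q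
  sDigits-block zero    zero    q _         = cong (sDigits b) (*-identityʳ q)
  sDigits-block zero    (suc r) q (s≤s ())
  sDigits-block (suc k) r q r<bᵏ⁺¹ = begin
    sDigits b (r + q * b ^ suc k)                ≡⟨ cong (sDigits b) regroup ⟩
    sDigits b (r % b + (r / b + q * b ^ k) * b)  ≡⟨ sDigits-digit (r % b) (r / b + q * b ^ k) (m%n<n r b) ⟩
    r % b + sDigits b (r / b + q * b ^ k)        ≡⟨ cong (r % b +_) (sDigits-block k (r / b) q high-digits) ⟩
    r % b + (sDigits b (r / b) + sDigits b q)    ≡⟨ sym (+-assoc (r % b) _ _) ⟩
    r % b + sDigits b (r / b) + sDigits b q      ≡⟨ cong (_+ sDigits b q) (sym (sDigits-unfold r)) ⟩
    sDigits b r + sDigits b q                    ∎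
    where
    open ≡-Reasoning
    high-digits : r / b < b ^ k
    high-digits = m<n*o⇒m/o<n (≤-trans r<bᵏ⁺¹ (≤-reflexive (*-comm b (b ^ k))))
    regroup : r + q * b ^ suc k ≡ r % b + (r / b + q * b ^ k) * b
    regroup = trans (cong (_+ q * b ^ suc k) (m≡m%n+[m/n]*n r b))
      (solve 5 (λ d h q p B → d :+ h :* B :+ q :* (B :* p) := d :+ (h :+ q :* p) :* B)
        refl (r % b) (r / b) q (b ^ k) b)

open DigitSum 2 (s≤s (s≤s z≤n))

negOnePow-double : ∀ a s → negOnePow (a + s + s) ≡ negOnePow a
negOnePow-double a zero    = cong negOnePow (trans (+-identityʳ (a + 0)) (+-identityʳ a))
negOnePow-double a (suc s) = begin
  negOnePow (a + suc s + suc s)         ≡⟨ cong negOnePow two-more ⟩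
  ℤ.- ℤ.- negOnePow (a + s + s)         ≡⟨ neg-involutive _ ⟩
  negOnePow (a + s + s)                 ≡⟨ negOnePow-double a s ⟩
  negOnePow a                           ∎
  where
  open ≡-Reasoning
  two-more : a + suc s + suc s ≡ suc (suc (a + s + s))
  two-more = trans (cong (_+ suc s) (+-suc a s)) (cong suc (+-suc (a + s) s))

sign-matters-only-at-one : ∀ (ε ε′ : ℤ) n → n < 2 → (n ≡ 1 → ε ≡ ε′) → ε ℤ.* ℤ.+ n ≡ ε′ ℤ.* ℤ.+ n
sign-matters-only-at-one ε ε′ zero          _                 _      = trans (*-zeroʳ ε) (sym (*-zeroʳ ε′))
sign-matters-only-at-one ε ε′ (suc zero)    _                 same-1 = cong (ℤ._* ℤ.+ 1) (same-1 refl)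
sign-matters-only-at-one ε ε′ (suc (suc n)) (s≤s (s≤s ()))    _

A₃<2 : ∀ x → A₃ x < 2
A₃<2 x = m<n*o⇒m/o<n (m%n<n x 8)

div4-decomposition : ∀ x → x / 4 ≡ A₃ x + x / 8 * 2
div4-decomposition x = begin
  x / 4                       ≡⟨ m≡m%n+[m/n]*n (x / 4) 2 ⟩
  x / 4 % 2 + x / 4 / 2 * 2   ≡⟨ cong₂ (λ u v → u + v * 2) (sym (m%[n*o]/o≡m/o%n x 2 4)) (m/n/o≡m/[n*o] x 4 2) ⟩
  A₃ x + x / 8 * 2            ∎
  where open ≡-Reasoning

exponent-decomposition : ∀ x → A₃ x ≡ 1 →
  s₂ x + s₂ (x / 4 ∸ 1) ≡ s₂ (x % 8) + s₂ (x / 8) + s₂ (x / 8)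
exponent-decomposition x A₃x≡1 = cong₂ _+_ low-and-high shifted
  where
  low-and-high : s₂ x ≡ s₂ (x % 8) + s₂ (x / 8)
  low-and-high = trans (cong s₂ (m≡m%n+[m/n]*n x 8)) (sDigits-block 3 (x % 8) (x / 8) (m%n<n x 8))
  shifted : s₂ (x / 4 ∸ 1) ≡ s₂ (x / 8)
  shifted = trans (cong (λ y → s₂ (y ∸ 1)) (trans (div4-decomposition x) (cong (_+ x / 8 * 2) A₃x≡1)))
                  (sDigits-digit 0 (x / 8) (s≤s z≤n))

residueValue : ℕ → ℤ
residueValue r = negOnePow (s₂ r) ℤ.* ℤ.+ (r / 4)

seqT-residue : ∀ x → seqT x ≡ residueValue (x % 8)
seqT-residue x = sign-matters-only-at-one _ _ (A₃ x) (A₃<2 x) λ A₃x≡1 →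
  trans (cong negOnePow (exponent-decomposition x A₃x≡1)) (negOnePow-double (s₂ (x % 8)) (s₂ (x / 8)))

lemma4 : (x : ℕ) → seqT (x + 8) ≡ seqT x
lemma4 x = begin
  seqT (x + 8)                ≡⟨ seqT-residue (x + 8) ⟩
  residueValue ((x + 8) % 8)  ≡⟨ cong residueValue ([m+n]%n≡m%n x 8) ⟩
  residueValue (x % 8)        ≡⟨ sym (seqT-residue x) ⟩
  seqT x                      ∎
  where open ≡-Reasoning
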